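{- Let $p$ be a prime, $R\ge 1$ an integer, $V=\mathbb{F}_{p^R}$, and let $k\ge 2$ be an integer dividing $p^R-1$ such that $\frac{p^R-1}{k}$ is even whenever $p$ is odd. Let $\omega$ be a primitive element of $\mathbb{F}_{p^R}$ and $S=\{\omega^{jk} : j\ge 0\}$. Suppose the generalised Paley graph $\Gamma=\mathrm{GPaley}(p^R,\frac{p^R-1}{k})=\mathrm{Cay}(V,S)$ is disconnected. Then $S$ is contained in a proper subfield $\mathbb{F}_{p^a}$ of $V$ (where $a$ is a proper divisor of $R$), and each connected component of $\Gamma$ is isomorphic to $\mathrm{GPaley}(p^a,\frac{p^a-1}{k'})=\mathrm{Cay}(\mathbb{F}_{p^a},S)$, where $k=\frac{p^R-1}{p^a-1}\cdot k'$.
   Context: For a finite field $V=\mathbb{F}_q$ ($q=p^R$), an integer $k\ge2$ with $k\mid q-1$ and $\frac{q-1}{k}$ even if $p$ is odd, and a fixed primitive element $\omega$ of $\mathbb{F}_q$, the generalised Paley graph $\mathrm{GPaley}(q,\frac{q-1}{k})$ is the Cayley graph $\mathrm{Cay}(V,S)$ of the additive group of $V$ with connection set $S=\{1,\omega^k,\omega^{2k},\dots,\omega^{q-1-k}\}$: its vertex set is $V$ and $\{u,v\}$ is an edge iff $v-u\in S$ (an undirected graph since $S=-S$). -}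

module Defs where

open import Level using (0ℓ)
open import Algebra.Bundles using (CommutativeRing)
open import Data.Nat as ℕ using (ℕ; zero; suc)
open import Data.Fin using (Fin)
open import Data.Product using (Σ; ∃; _×_; _,_; proj₁; proj₂)
open import Relation.Nullary using (¬_)
open import Relation.Binary.PropositionalEquality using (_≡_)
open import Function.Bundles using (_⇔_)

record FiniteField : Set₁ where
  field
    cring : CommutativeRing 0ℓ 0ℓ
  open CommutativeRing cring public
  field
    nontrivial : ¬ (0# ≈ 1#)
    inverse    : ∀ x → ¬ (x ≈ 0#) → ∃ λ y → x * y ≈ 1#
    size       : ℕ
    enum       : Fin size → Carrier
    enum-inj   : ∀ i j → enum i ≈ enum j → i ≡ j
    enum-surj  : ∀ x → ∃ λ i → enum i ≈ x

module _ (F : FiniteField) where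
  open FiniteField F

  pow : Carrier → ℕ → Carrier
  pow x zero    = 1#
  pow x (suc n) = x * pow x n

  IsPrimitive : Carrier → Set
  IsPrimitive ω = ¬ (ω ≈ 0#) × (∀ x → ¬ (x ≈ 0#) → ∃ λ i → pow ω i ≈ x)

  InS : Carrier → ℕ → Carrier → Set
  InS ω k x = ∃ λ j → x ≈ pow ω (j ℕ.* k)

  Adj : Carrier → ℕ → Carrier → Carrier → Set
  Adj ω k u v = InS ω k (v - u)

  data Reach (ω : Carrier) (k : ℕ) (u : Carrier) : Carrier → Set where
    here : ∀ {v} → u ≈ v → Reach ω k u v
    step : ∀ {w v} → Reach ω k u w → Adj ω k w v → Reach ω k u v

  Disconnected : Carrier → ℕ → Set
  Disconnected ω k = ∃ λ u → ∃ λ v → ¬ Reach ω k u v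

  record Subfield (P : Carrier → Set) (m : ℕ) : Set where
    field
      resp    : ∀ {x y} → x ≈ y → P x → P y
      has-0   : P 0#
      has-1   : P 1#
      +-clos  : ∀ {x y} → P x → P y → P (x + y)
      neg-clos : ∀ {x} → P x → P (- x)
      *-clos  : ∀ {x y} → P x → P y → P (x * y)
      inv-clos : ∀ {x y} → P x → x * y ≈ 1# → P y
      enumP     : Fin m → Carrier
      enumP-in  : ∀ i → P (enumP i)
      enumP-inj : ∀ i j → enumP i ≈ enumP j → i ≡ j
      enumP-surj : ∀ x → P x → ∃ λ i → enumP i ≈ x

  IsPrimitiveIn : (Carrier → Set) → Carrier → Set
  IsPrimitiveIn P η = P η × ¬ (η ≈ 0#) × (∀ x → P x → ¬ (x ≈ 0#) → ∃ λ i → pow η i ≈ x)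

  -- Graph isomorphism between the connected component of u in Cay(V,S)
  -- (vertices Σ v. Reach u v) and the Cayley graph Cay(P, T) on the subfield P
  -- whose connection set is given by the predicate T.
  record ComponentIso (ω : Carrier) (k : ℕ) (u : Carrier)
                      (P : Carrier → Set) (T : Carrier → Set) : Set where
    Comp : Set
    Comp = Σ Carrier (Reach ω k u)
    Sub : Set
    Sub = Σ Carrier P
    field
      to     : Comp → Sub
      from   : Sub → Comp
      to-cong   : ∀ x y → proj₁ x ≈ proj₁ y → proj₁ (to x) ≈ proj₁ (to y)
      from-cong : ∀ x y → proj₁ x ≈ proj₁ y → proj₁ (from x) ≈ proj₁ (from y)
      from-to : ∀ x → proj₁ (from (to x)) ≈ proj₁ x
      to-from : ∀ y → proj₁ (to (from y)) ≈ proj₁ y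
      adj-pres : ∀ x y → Adj ω k (proj₁ x) (proj₁ y) ⇔ T (proj₁ (to y) - proj₁ (to x))

module Submission where

-- The component C₀ of 0 in Cay(F, S) is closed under addition, because the graph is
-- translation invariant, and under multiplication, because S is a multiplicative monoid;
-- finiteness supplies negatives and inverses, so C₀ is a subfield containing S.
-- Bounded reachability stabilises on the finite vertex set, so membership in C₀ is
-- decidable, and the nonzero elements of C₀ are the powers of η = ωᵐ for the least m > 0
-- with ωᵐ ∈ C₀; in particular m divides |F| − 1 and k.  Viewing F as a vector space over
-- C₀, a vertex outside C₀ forces |F| = |C₀|ᵈ with d ≥ 2, so |C₀| = pᵃ with a ∣ R, a < R.
-- Every other component is a translate of C₀.

open import Defs
open import Level using (0ℓ)
open import Data.Empty using (⊥-elim)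
open import Data.Fin as Fin using (Fin; toℕ)
import Data.Fin.Properties as Fin
open import Data.Fin.Subset using (Subset; _∈_; _⊆_; _⊃_)
open import Data.Fin.Subset.Properties using (_∈?_; _⊂?_)
open import Data.Fin.Subset.Induction using (⊃-wellFounded; Acc; acc)
open import Data.Nat as ℕ using (ℕ; zero; suc; _≤_; _<_; z≤n; s≤s)
import Data.Nat.Properties as ℕ
open import Data.Nat.DivMod using (_%_; _/_; m≡m%n+[m/n]*n; m%n<n)
open import Data.Nat.Divisibility
  using (_∣_; _∣?_; divides; quotient; m%n≡0⇒n∣m; >⇒∤; ∣1⇒≡1; *-cancelˡ-∣; m∣m*n)
open import Data.Nat.Induction using (<-rec)
open import Data.Nat.Primality using (Prime; prime⇒nonZero; prime⇒nonTrivial; prime⇒irreducible)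
open import Data.Nat.Coprimality using (Coprime; coprime-divisor)
open import Data.Product using (Σ; ∃; ∃₂; _×_; _,_; proj₁; proj₂)
open import Data.Sum using (_⊎_; inj₁; inj₂)
open import Relation.Binary.Definitions using (tri<; tri≈; tri>)
open import Data.Vec using (Vec; []; _∷_; tabulate)
open import Data.Vec.Properties using (lookup⇒[]=; []=⇒lookup; lookup∘tabulate)
open import Data.Vec.Recursive using (Fin[m^n]↔Fin[m]^n)
open import Data.Vec.Recursive.Properties using (↔Vec)
open import Function using (_∘_)
open import Function.Bundles using (_⇔_; mk⇔; _↔_; Inverse)
open import Function.Properties.Inverse using (↔-trans)
open import Relation.Nullary using (¬_; Dec; yes; no; does)
open import Relation.Nullary.Decidable using (map′; _×-dec_; _⊎-dec_; ¬?; decidable-stable)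
open import Relation.Unary using (Pred)
open import Relation.Binary.PropositionalEquality as ≡ using (_≡_; _≢_)

Least : (ℕ → Set) → Set
Least Q = ∃ λ m → Q m × (∀ {s} → s < m → ¬ Q s)

least : ∀ {Q : ℕ → Set} → (∀ n → Dec (Q n)) → ∀ n → Q n → Least Q
least {Q} Q? = <-rec (λ n → Q n → Least Q) search
  where
  search : ∀ n → (∀ {m} → m < n → Q m → Least Q) → Q n → Least Q
  search n below qn with Fin.any? (λ (i : Fin n) → Q? (toℕ i))
  ... | yes (i , qi) = below (Fin.toℕ<n i) qi
  ... | no none = n , qn , λ s<n qs →
    none (Fin.fromℕ< s<n , ≡.subst Q (≡.sym (Fin.toℕ-fromℕ< s<n)) qs)

∣∧<⇒≡0 : ∀ {m n} → n ∣ m → m < n → m ≡ 0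
∣∧<⇒≡0 {zero}  _   _   = ≡.refl
∣∧<⇒≡0 {suc m} n∣m m<n = ⊥-elim (>⇒∤ m<n n∣m)

module _ where
  open import Data.Nat using (_+_; _*_; _^_)
  open ℕ.≤-Reasoning

  n<c^n : ∀ {c} → 2 ≤ c → ∀ n → n < c ^ n
  n<c^n 2≤c zero = s≤s z≤n
  n<c^n {c} 2≤c (suc n) = begin-strict
    suc n           ≤⟨ n<c^n 2≤c n ⟩
    c ^ n           <⟨ ℕ.m<m+n (c ^ n) (ℕ.<-≤-trans (s≤s z≤n) (n<c^n 2≤c n)) ⟩
    c ^ n + c ^ n   ≡⟨ ≡.cong (c ^ n +_) (≡.sym (ℕ.+-identityʳ (c ^ n))) ⟩
    2 * c ^ n       ≤⟨ ℕ.*-monoˡ-≤ (c ^ n) 2≤c ⟩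
    c * c ^ n       ∎

  module _ {p : ℕ} (p-prime : Prime p) where
    private
      instance
        p≢0 : ℕ.NonZero p
        p≢0 = prime⇒nonZero p-prime

      1<p : 1 < p
      1<p = ℕ.nonTrivial⇒n>1 p {{prime⇒nonTrivial p-prime}}

    ∣p^R⇒≡p^a : ∀ R {c} → c ∣ p ^ R → ∃ λ a → c ≡ p ^ a
    ∣p^R⇒≡p^a zero    c∣1 = 0 , ∣1⇒≡1 c∣1
    ∣p^R⇒≡p^a (suc R) {c} c∣p^[1+R] with p ∣? c
    ... | yes (divides c′ c≡c′*p) =
      let c≡p*c′  = ≡.trans c≡c′*p (ℕ.*-comm c′ p)
          a , c′≡pᵃ = ∣p^R⇒≡p^a R (*-cancelˡ-∣ p (≡.subst (_∣ p * p ^ R) c≡p*c′ c∣p^[1+R]))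
      in suc a , ≡.trans c≡p*c′ (≡.cong (p *_) c′≡pᵃ)
    ... | no p∤c = ∣p^R⇒≡p^a R (coprime-divisor c⊥p c∣p^[1+R])
      where
      c⊥p : Coprime c p
      c⊥p (i∣c , i∣p) with prime⇒irreducible p-prime i∣p
      ... | inj₁ i≡1    = i≡1
      ... | inj₂ ≡.refl = ⊥-elim (p∤c i∣c)

    ^-injectiveʳ : ∀ {a b} → p ^ a ≡ p ^ b → a ≡ b
    ^-injectiveʳ {a} {b} pᵃ≡pᵇ with ℕ.<-cmp a b
    ... | tri< a<b _ _ = ⊥-elim (ℕ.<-irrefl pᵃ≡pᵇ (ℕ.^-monoʳ-< p 1<p a<b))
    ... | tri≈ _ a≡b _ = a≡b
    ... | tri> _ _ b<a = ⊥-elim (ℕ.<-irrefl (≡.sym pᵃ≡pᵇ) (ℕ.^-monoʳ-< p 1<p b<a))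

    subfield-exponent : ∀ {c d R} → 2 ≤ d → 1 ≤ R → c ^ d ≡ p ^ R →
      ∃ λ a → c ≡ p ^ a × a ∣ R × a < R
    subfield-exponent {c} {d@(suc d′)} {R} 2≤d 1≤R cᵈ≡pᴿ =
      a , c≡pᵃ , divides d (≡.trans (≡.sym a*d≡R) (ℕ.*-comm a d)) , a<R a a*d≡R
      where
      c≡pᵃ′ = ∣p^R⇒≡p^a R (≡.subst (c ∣_) cᵈ≡pᴿ (m∣m*n (c ^ d′)))
      a = proj₁ c≡pᵃ′
      c≡pᵃ = proj₂ c≡pᵃ′
      a*d≡R : a * d ≡ R
      a*d≡R = ^-injectiveʳ (≡.trans (≡.sym (ℕ.^-*-assoc p a d))
                (≡.trans (≡.cong (_^ d) (≡.sym c≡pᵃ)) cᵈ≡pᴿ))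
      a<R : ∀ a → a * d ≡ R → a < R
      a<R zero    _     = 1≤R
      a<R (suc a) a*d≡R = ≡.subst (suc a <_) a*d≡R (ℕ.m<m*n (suc a) d 2≤d)

module _ {n : ℕ} where

  ⟦_⟧ : {Q : Pred (Fin n) 0ℓ} → (∀ i → Dec (Q i)) → Subset n
  ⟦ Q? ⟧ = tabulate (λ i → does (Q? i))

  ⟦⟧-sound : {Q : Pred (Fin n) 0ℓ} (Q? : ∀ i → Dec (Q i)) {i : Fin n} → i ∈ ⟦ Q? ⟧ → Q i
  ⟦⟧-sound Q? {i} i∈ with Q? i | ≡.trans (≡.sym (lookup∘tabulate (does ∘ Q?) i)) ([]=⇒lookup i∈)
  ... | yes q | _ = q
  ... | no _  | ()

  ⟦⟧-complete : {Q : Pred (Fin n) 0ℓ} (Q? : ∀ i → Dec (Q i)) {i : Fin n} → Q i → i ∈ ⟦ Q? ⟧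
  ⟦⟧-complete Q? {i} q with Q? i | lookup∘tabulate (does ∘ Q?) i
  ... | yes _ | eq = lookup⇒[]= i _ eq
  ... | no ¬q | _  = ⊥-elim (¬q q)

  ascending-chain-stabilises : (f : ℕ → Subset n) → (∀ t → f t ⊆ f (suc t)) →
    ∃ λ t → f (suc t) ⊆ f t
  ascending-chain-stabilises f f-mono = climb 0 (⊃-wellFounded (f 0))
    where
    climb : ∀ t → Acc _⊃_ (f t) → ∃ λ t → f (suc t) ⊆ f t
    climb t (acc rs) with f t ⊂? f (suc t)
    ... | yes f⊂f′ = climb (suc t) (rs f⊂f′)
    ... | no ¬f⊂f′ = t , shrink
      where
      shrink : f (suc t) ⊆ f t
      shrink {x} x∈f′ with x ∈? f t
      ... | yes x∈f = x∈f
      ... | no x∉f  = ⊥-elim (¬f⊂f′ (f-mono t , x , x∈f′ , x∉f))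

  decidable-chain-stabilises : {Q : ℕ → Pred (Fin n) 0ℓ} (Q? : ∀ t i → Dec (Q t i)) →
    (∀ t {i} → Q t i → Q (suc t) i) → ∃ λ t → ∀ {i} → Q (suc t) i → Q t i
  decidable-chain-stabilises Q? Q-mono
    with ascending-chain-stabilises (λ t → ⟦ Q? t ⟧)
           (λ t → ⟦⟧-complete (Q? (suc t)) ∘ Q-mono t ∘ ⟦⟧-sound (Q? t))
  ... | t , shrink = t , ⟦⟧-sound (Q? t) ∘ shrink ∘ ⟦⟧-complete (Q? (suc t))

module FieldTheory (F : FiniteField) where
  open FiniteField F
  open import Relation.Binary.Reasoning.Setoid setoid
  open import Algebra.Properties.Ring ring using (-‿distribˡ-*; -0#≈0#; x[y-z]≈xy-xz; [y-z]x≈yx-zx)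
  open import Algebra.Properties.Group +-group
    using (∙-cancelˡ; //-rightDividesˡ; //-rightDividesʳ; inverseʳ-unique; x∙y⁻¹≈ε⇒x≈y)
  open import Algebra.Properties.AbelianGroup +-abelianGroup using (⁻¹-∙-comm)
  open import Algebra.Properties.CommutativeSemigroup +-commutativeSemigroup using (interchange)
  open import Algebra.Properties.Monoid.Mult +-monoid using (×-homo-+) renaming (_×_ to _·_)

  index : Carrier → Fin size
  index x = proj₁ (enum-surj x)

  enum-index : ∀ x → enum (index x) ≈ x
  enum-index x = proj₂ (enum-surj x)

  index-injective : ∀ {x y} → index x ≡ index y → x ≈ y
  index-injective {x} {y} eq =
    trans (sym (enum-index x)) (trans (reflexive (≡.cong enum eq)) (enum-index y))

  infix 4 _≟_
  _≟_ : ∀ x y → Dec (x ≈ y)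
  x ≟ y = map′ index-injective
    (λ x≈y → enum-inj _ _ (trans (enum-index x) (trans x≈y (sym (enum-index y)))))
    (index x Fin.≟ index y)

  ≤-size : ∀ {n} (e : Fin n → Carrier) → (∀ {i j} → e i ≈ e j → i ≡ j) → n ≤ size
  ≤-size e e-injective = Fin.injective⇒≤ (e-injective ∘ index-injective)

  size-≤ : ∀ {n} (e : Fin n → Carrier) → (∀ x → ∃ λ i → e i ≈ x) → size ≤ n
  size-≤ e e-surjective = Fin.injective⇒≤ {f = λ i → proj₁ (e-surjective (enum i))} λ {i} {j} eq →
    enum-inj i j (trans (sym (proj₂ (e-surjective (enum i))))
                 (trans (reflexive (≡.cong e eq)) (proj₂ (e-surjective (enum j)))))

  x+y-y≈x : ∀ x y → (x + y) - y ≈ x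
  x+y-y≈x x y = //-rightDividesʳ y x

  x-y+y≈x : ∀ x y → (x - y) + y ≈ x
  x-y+y≈x x y = //-rightDividesˡ y x

  [x+z]-[y+z]≈x-y : ∀ x y z → (x + z) - (y + z) ≈ x - y
  [x+z]-[y+z]≈x-y x y z = begin
    (x + z) + - (y + z)   ≈⟨ +-congˡ (sym (⁻¹-∙-comm y z)) ⟩
    (x + z) + (- y + - z) ≈⟨ interchange x z (- y) (- z) ⟩
    (x - y) + (z - z)     ≈⟨ +-congˡ (-‿inverseʳ z) ⟩
    (x - y) + 0#          ≈⟨ +-identityʳ (x - y) ⟩
    x - y                 ∎

  x+y≈z+w⇒x-z≈w-y : ∀ {x y z w} → x + y ≈ z + w → x - z ≈ w - y
  x+y≈z+w⇒x-z≈w-y {x} {y} {z} {w} eq = begin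
    x - z             ≈⟨ sym ([x+z]-[y+z]≈x-y x z y) ⟩
    (x + y) - (z + y) ≈⟨ +-cong (trans eq (+-comm z w)) (-‿cong (+-comm z y)) ⟩
    (w + z) - (y + z) ≈⟨ [x+z]-[y+z]≈x-y w y z ⟩
    w - y             ∎

  eventually-repeats : (g : ℕ → Carrier) → ∃₂ λ i n → g i ≈ g (i ℕ.+ suc n)
  eventually-repeats g with Fin.pigeonhole (ℕ.n<1+n size) (λ (i : Fin (suc size)) → index (g (toℕ i)))
  ... | i , j , i<j , eq with ℕ.m≤n⇒∃[o]m+o≡n i<j
  ... | n , i+1+n≡j = toℕ i , n , trans (index-injective eq)
    (reflexive (≡.cong g (≡.trans (≡.sym i+1+n≡j) (≡.sym (ℕ.+-suc (toℕ i) n)))))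

  -x≈n·x : ∀ x → ∃ λ n → - x ≈ n · x
  -x≈n·x x with eventually-repeats (_· x)
  ... | i , n , eq = n , sym (inverseʳ-unique x (n · x) (sym (∙-cancelˡ (i · x) 0# (suc n · x) (begin
    i · x + 0#          ≈⟨ +-identityʳ (i · x) ⟩
    i · x               ≈⟨ eq ⟩
    (i ℕ.+ suc n) · x   ≈⟨ ×-homo-+ x i (suc n) ⟩
    i · x + suc n · x   ∎))))

  1≉0 : 1# ≉ 0#
  1≉0 1≈0 = nontrivial (sym 1≈0)

  *-cancelˡ-≉0 : ∀ {x y z} → x ≉ 0# → x * y ≈ x * z → y ≈ z
  *-cancelˡ-≉0 {x} {y} {z} x≉0 xy≈xz with inverse x x≉0
  ... | x⁻¹ , xx⁻¹≈1 = trans (sym (cancel y)) (trans (*-congˡ xy≈xz) (cancel z))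
    where
    cancel : ∀ w → x⁻¹ * (x * w) ≈ w
    cancel w = trans (sym (*-assoc x⁻¹ x w))
      (trans (*-congʳ (trans (*-comm x⁻¹ x) xx⁻¹≈1)) (*-identityˡ w))

  *-≉0 : ∀ {x y} → x ≉ 0# → y ≉ 0# → x * y ≉ 0#
  *-≉0 {x} x≉0 y≉0 xy≈0 = y≉0 (*-cancelˡ-≉0 x≉0 (trans xy≈0 (sym (zeroʳ x))))

  infixr 8 _^_
  _^_ : Carrier → ℕ → Carrier
  _^_ = pow F

  ^-cong : ∀ {x y} n → x ≈ y → x ^ n ≈ y ^ n
  ^-cong zero    _   = refl
  ^-cong (suc n) x≈y = *-cong x≈y (^-cong n x≈y)

  ^-≡ : ∀ x {m n} → m ≡ n → x ^ m ≈ x ^ n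
  ^-≡ x m≡n = reflexive (≡.cong (x ^_) m≡n)

  ^-homo-+ : ∀ x m n → x ^ (m ℕ.+ n) ≈ x ^ m * x ^ n
  ^-homo-+ x zero    n = sym (*-identityˡ (x ^ n))
  ^-homo-+ x (suc m) n = trans (*-congˡ (^-homo-+ x m n)) (sym (*-assoc x (x ^ m) (x ^ n)))

  ^-* : ∀ x m n → x ^ (m ℕ.* n) ≈ (x ^ n) ^ m
  ^-* x zero    n = refl
  ^-* x (suc m) n = trans (^-homo-+ x n (m ℕ.* n)) (*-congˡ (^-* x m n))

  1^n≈1 : ∀ n → 1# ^ n ≈ 1#
  1^n≈1 zero    = refl
  1^n≈1 (suc n) = trans (*-identityˡ (1# ^ n)) (1^n≈1 n)

  ^-≉0 : ∀ {x} n → x ≉ 0# → x ^ n ≉ 0#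
  ^-≉0 zero    _   = 1≉0
  ^-≉0 (suc n) x≉0 = *-≉0 x≉0 (^-≉0 n x≉0)

  ^-period : ∀ {x} → x ≉ 0# → ∃ λ n → x ^ suc n ≈ 1#
  ^-period {x} x≉0 with eventually-repeats (x ^_)
  ... | i , n , eq = n , sym (*-cancelˡ-≉0 (^-≉0 i x≉0) (begin
    x ^ i * 1#           ≈⟨ *-identityʳ (x ^ i) ⟩
    x ^ i                ≈⟨ eq ⟩
    x ^ (i ℕ.+ suc n)    ≈⟨ ^-homo-+ x i (suc n) ⟩
    x ^ i * x ^ suc n    ∎))

  ^-mod : ∀ {x} n .{{_ : ℕ.NonZero n}} → x ^ n ≈ 1# → ∀ e → x ^ e ≈ x ^ (e % n)
  ^-mod {x} n xⁿ≈1 e = begin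
    x ^ e                              ≈⟨ ^-≡ x (m≡m%n+[m/n]*n e n) ⟩
    x ^ (e % n ℕ.+ e / n ℕ.* n)        ≈⟨ ^-homo-+ x (e % n) (e / n ℕ.* n) ⟩
    x ^ (e % n) * x ^ (e / n ℕ.* n)    ≈⟨ *-congˡ (^-* x (e / n) n) ⟩
    x ^ (e % n) * (x ^ n) ^ (e / n)    ≈⟨ *-congˡ (trans (^-cong (e / n) xⁿ≈1) (1^n≈1 (e / n))) ⟩
    x ^ (e % n) * 1#                   ≈⟨ *-identityʳ (x ^ (e % n)) ⟩
    x ^ (e % n)                        ∎

  powers? : ∀ {g} → g ≉ 0# → ∀ x → Dec (∃ λ j → x ≈ g ^ j)
  powers? {g} g≉0 x with ^-period g≉0
  ... | n , gⁿ≈1 = map′ (λ (j , x≈gʲ) → toℕ j , x≈gʲ)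
    (λ (j , x≈gʲ) → Fin.fromℕ< (m%n<n j (suc n)) ,
       trans x≈gʲ (trans (^-mod (suc n) gⁿ≈1 j) (^-≡ g (≡.sym (Fin.toℕ-fromℕ< (m%n<n j (suc n)))))))
    (Fin.any? λ (j : Fin (suc n)) → x ≟ g ^ toℕ j)

  zeroAndPowers : Carrier → (n : ℕ) → Fin (suc n) → Carrier
  zeroAndPowers g n Fin.zero    = 0#
  zeroAndPowers g n (Fin.suc i) = g ^ toℕ i

  zeroAndPowers-injective : ∀ {g n} → g ≉ 0# →
    (∀ {i j} → i < n → j < n → g ^ i ≈ g ^ j → i ≡ j) →
    ∀ {a b} → zeroAndPowers g n a ≈ zeroAndPowers g n b → a ≡ b
  zeroAndPowers-injective g≉0 _ {Fin.zero}  {Fin.zero}  _ = ≡.refl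
  zeroAndPowers-injective g≉0 _ {Fin.zero}  {Fin.suc j} 0≈gʲ = ⊥-elim (^-≉0 (toℕ j) g≉0 (sym 0≈gʲ))
  zeroAndPowers-injective g≉0 _ {Fin.suc i} {Fin.zero}  gⁱ≈0 = ⊥-elim (^-≉0 (toℕ i) g≉0 gⁱ≈0)
  zeroAndPowers-injective g≉0 ^-injective {Fin.suc i} {Fin.suc j} gⁱ≈gʲ =
    ≡.cong Fin.suc (Fin.toℕ-injective (^-injective (Fin.toℕ<n i) (Fin.toℕ<n j) gⁱ≈gʲ))

  zeroAndPowers-reaches : ∀ {g n x} → (x ≉ 0# → ∃ λ i → i < n × g ^ i ≈ x) →
    ∃ λ a → zeroAndPowers g n a ≈ x
  zeroAndPowers-reaches {g} {x = x} log with x ≟ 0#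
  ... | yes x≈0 = Fin.zero , sym x≈0
  ... | no x≉0 with log x≉0
  ...   | i , i<n , gⁱ≈x = Fin.suc (Fin.fromℕ< i<n) , trans (^-≡ g (Fin.toℕ-fromℕ< i<n)) gⁱ≈x

  module LeastExponent {ω : Carrier} (ω≉0 : ω ≉ 0#) {H : Carrier → Set} (H? : ∀ x → Dec (H x))
    (H-resp : ∀ {x y} → x ≈ y → H x → H y) (H-1 : H 1#)
    (H-* : ∀ {x y} → H x → H y → H (x * y)) (H-inverse : ∀ {x y} → H x → x * y ≈ 1# → H y)
    {n : ℕ} .{{_ : ℕ.NonZero n}} (H-ωⁿ : H (ω ^ n)) where

    private
      minimal : Least (λ e → H (ω ^ suc e))
      minimal = least (λ e → H? (ω ^ suc e)) (ℕ.pred n) (H-resp (^-≡ ω (≡.sym (ℕ.suc-pred n))) H-ωⁿ)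

    exponent : ℕ
    exponent = suc (proj₁ minimal)

    H-ω^exponent : H (ω ^ exponent)
    H-ω^exponent = proj₁ (proj₂ minimal)

    H-^ : ∀ {x} m → H x → H (x ^ m)
    H-^ zero    _  = H-1
    H-^ (suc m) Hx = H-* Hx (H-^ m Hx)

    exponent-∣ : ∀ {e} → H (ω ^ e) → exponent ∣ e
    exponent-∣ {e} H-ωᵉ = m%n≡0⇒n∣m e exponent (remainder≡0 (m%n<n e exponent) H-ω^remainder)
      where
      z = ω ^ (e / exponent ℕ.* exponent)
      z≉0 = ^-≉0 (e / exponent ℕ.* exponent) ω≉0
      z⁻¹ = proj₁ (inverse z z≉0)

      ωᵉz⁻¹≈ω^remainder : ω ^ e * z⁻¹ ≈ ω ^ (e % exponent)
      ωᵉz⁻¹≈ω^remainder = begin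
        ω ^ e * z⁻¹                  ≈⟨ *-congʳ (^-≡ ω (m≡m%n+[m/n]*n e exponent)) ⟩
        ω ^ (e % exponent ℕ.+ _) * z⁻¹ ≈⟨ *-congʳ (^-homo-+ ω (e % exponent) _) ⟩
        (ω ^ (e % exponent) * z) * z⁻¹ ≈⟨ *-assoc _ z z⁻¹ ⟩
        ω ^ (e % exponent) * (z * z⁻¹) ≈⟨ *-congˡ (proj₂ (inverse z z≉0)) ⟩
        ω ^ (e % exponent) * 1#        ≈⟨ *-identityʳ _ ⟩
        ω ^ (e % exponent)             ∎

      H-ω^remainder : H (ω ^ (e % exponent))
      H-ω^remainder = H-resp ωᵉz⁻¹≈ω^remainder (H-* H-ωᵉ (H-inverse H-z (proj₂ (inverse z z≉0))))
        where
        H-z : H z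
        H-z = H-resp (sym (^-* ω (e / exponent) exponent)) (H-^ (e / exponent) H-ω^exponent)

      remainder≡0 : ∀ {r} → r < exponent → H (ω ^ r) → r ≡ 0
      remainder≡0 {zero}  _       _ = ≡.refl
      remainder≡0 {suc r} (s≤s r<) H-ωʳ⁺¹ = ⊥-elim (proj₂ (proj₂ minimal) r< H-ωʳ⁺¹)

  module Cyclic {ω : Carrier} (prim : IsPrimitive F ω) where

    ω≉0 : ω ≉ 0#
    ω≉0 = proj₁ prim

    private
      module Order = LeastExponent ω≉0 (_≟ 1#) (λ x≈y x≈1 → trans (sym x≈y) x≈1) refl
        (λ x≈1 y≈1 → trans (*-cong x≈1 y≈1) (*-identityˡ 1#))
        (λ {x} {y} x≈1 xy≈1 → trans (sym (*-identityˡ y)) (trans (*-congʳ (sym x≈1)) xy≈1))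
        {suc (proj₁ (^-period ω≉0))} (proj₂ (^-period ω≉0))

    order : ℕ
    order = Order.exponent

    ω^order≈1 : ω ^ order ≈ 1#
    ω^order≈1 = Order.H-ω^exponent

    ^-injective-≤ : ∀ {i j} → i ≤ j → j < order → ω ^ i ≈ ω ^ j → i ≡ j
    ^-injective-≤ {i} i≤j j< ωⁱ≈ωʲ with ℕ.m≤n⇒∃[o]m+o≡n i≤j
    ... | o , ≡.refl = ≡.sym (≡.trans (≡.cong (i ℕ.+_) o≡0) (ℕ.+-identityʳ i))
      where
      ωᵒ≈1 : ω ^ o ≈ 1#
      ωᵒ≈1 = sym (*-cancelˡ-≉0 (^-≉0 i ω≉0) (begin
        ω ^ i * 1#       ≈⟨ *-identityʳ (ω ^ i) ⟩
        ω ^ i            ≈⟨ ωⁱ≈ωʲ ⟩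
        ω ^ (i ℕ.+ o)    ≈⟨ ^-homo-+ ω i o ⟩
        ω ^ i * ω ^ o    ∎))
      o≡0 : o ≡ 0
      o≡0 = ∣∧<⇒≡0 (Order.exponent-∣ ωᵒ≈1) (ℕ.≤-<-trans (ℕ.m≤n+m o i) j<)

    ^-injective : ∀ {i j} → i < order → j < order → ω ^ i ≈ ω ^ j → i ≡ j
    ^-injective {i} {j} i< j< ωⁱ≈ωʲ with ℕ.≤-total i j
    ... | inj₁ i≤j = ^-injective-≤ i≤j j< ωⁱ≈ωʲ
    ... | inj₂ j≤i = ≡.sym (^-injective-≤ j≤i i< (sym ωⁱ≈ωʲ))

    log : ∀ {x} → x ≉ 0# → ∃ λ e → e < order × ω ^ e ≈ x
    log {x} x≉0 with proj₂ prim x x≉0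
    ... | e , ωᵉ≈x = e % order , m%n<n e order , trans (sym (^-mod order ω^order≈1 e)) ωᵉ≈x

    size≡1+order : size ≡ suc order
    size≡1+order = ℕ.≤-antisym
      (size-≤ (zeroAndPowers ω order) (λ x → zeroAndPowers-reaches log))
      (≤-size (zeroAndPowers ω order) (zeroAndPowers-injective ω≉0 ^-injective))

  module Component {ω : Carrier} (ω≉0 : ω ≉ 0#) (k : ℕ) where

    S : Carrier → Set
    S = InS F ω k

    S-resp : ∀ {x y} → x ≈ y → S x → S y
    S-resp x≈y (j , x≈) = j , trans (sym x≈y) x≈

    1∈S : S 1#
    1∈S = 0 , refl

    S-* : ∀ {x y} → S x → S y → S (x * y)
    S-* {x} {y} (i , x≈) (j , y≈) = i ℕ.+ j , (begin
      x * y                           ≈⟨ *-cong x≈ y≈ ⟩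
      ω ^ (i ℕ.* k) * ω ^ (j ℕ.* k)   ≈⟨ sym (^-homo-+ ω (i ℕ.* k) (j ℕ.* k)) ⟩
      ω ^ (i ℕ.* k ℕ.+ j ℕ.* k)       ≈⟨ ^-≡ ω (≡.sym (ℕ.*-distribʳ-+ k i j)) ⟩
      ω ^ ((i ℕ.+ j) ℕ.* k)           ∎)

    S? : ∀ x → Dec (S x)
    S? x = map′ (λ (j , x≈) → j , trans x≈ (sym (^-* ω j k))) (λ (j , x≈) → j , trans x≈ (^-* ω j k))
      (powers? (^-≉0 k ω≉0) x)

    reach-resp : ∀ {u x y} → Reach F ω k u x → x ≈ y → Reach F ω k u y
    reach-resp (here u≈x)    x≈y = here (trans u≈x x≈y)
    reach-resp (step r adj)  x≈y = step r (S-resp (+-congʳ x≈y) adj)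

    reach-respˡ : ∀ {u u′ x} → u ≈ u′ → Reach F ω k u x → Reach F ω k u′ x
    reach-respˡ u≈u′ (here u≈x)   = here (trans (sym u≈u′) u≈x)
    reach-respˡ u≈u′ (step r adj) = step (reach-respˡ u≈u′ r) adj

    reach-+ : ∀ {a b} t → Reach F ω k a b → Reach F ω k (a + t) (b + t)
    reach-+ t (here a≈b) = here (+-congʳ a≈b)
    reach-+ {b = b} t (step {w} r adj) =
      step (reach-+ t r) (S-resp (sym ([x+z]-[y+z]≈x-y b w t)) adj)

    reach-trans : ∀ {a b c} → Reach F ω k a b → Reach F ω k b c → Reach F ω k a c
    reach-trans r (here b≈c)    = reach-resp r b≈c
    reach-trans r (step r′ adj) = step (reach-trans r r′) adj

    C₀ : Carrier → Set
    C₀ = Reach F ω k 0#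

    C₀⇒reach : ∀ {u v} → C₀ (v - u) → Reach F ω k u v
    C₀⇒reach {u} {v} c = reach-respˡ (+-identityˡ u) (reach-resp (reach-+ u c) (x-y+y≈x v u))

    reach⇒C₀ : ∀ {u v} → Reach F ω k u v → C₀ (v - u)
    reach⇒C₀ {u} r = reach-respˡ (-‿inverseʳ u) (reach-+ (- u) r)

    0∈C₀ : C₀ 0#
    0∈C₀ = here refl

    S⊆C₀ : ∀ {s} → S s → C₀ s
    S⊆C₀ {s} s∈S = step 0∈C₀ (S-resp (sym (trans (+-congˡ (-0#≈0#)) (+-identityʳ s))) s∈S)

    1∈C₀ : C₀ 1#
    1∈C₀ = S⊆C₀ 1∈S

    C₀-+ : ∀ {x y} → C₀ x → C₀ y → C₀ (x + y)
    C₀-+ {x} {y} cx cy =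
      reach-trans cx (reach-respˡ (+-identityˡ x) (reach-resp (reach-+ x cy) (+-comm y x)))

    S*C₀⊆C₀ : ∀ {s y} → S s → C₀ y → C₀ (s * y)
    S*C₀⊆C₀ {s} s∈S (here 0≈y) = here (trans (sym (zeroʳ s)) (*-congˡ 0≈y))
    S*C₀⊆C₀ {s} {y} s∈S (step {w} r adj) =
      reach-resp (C₀-+ (S*C₀⊆C₀ s∈S r) (S⊆C₀ (S-* s∈S adj))) (begin
      s * w + s * (y - w)   ≈⟨ sym (distribˡ s w (y - w)) ⟩
      s * (w + (y - w))     ≈⟨ *-congˡ (trans (+-comm w (y - w)) (x-y+y≈x y w)) ⟩
      s * y                 ∎)

    C₀-* : ∀ {x y} → C₀ x → C₀ y → C₀ (x * y)
    C₀-* {y = y} (here 0≈x) cy = here (trans (sym (zeroˡ y)) (*-congʳ 0≈x))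
    C₀-* {x} {y} (step {w} r adj) cy = reach-resp (C₀-+ (C₀-* r cy) (S*C₀⊆C₀ adj cy)) (begin
      w * y + (x - w) * y   ≈⟨ sym (distribʳ y w (x - w)) ⟩
      (w + (x - w)) * y     ≈⟨ *-congʳ (trans (+-comm w (x - w)) (x-y+y≈x x w)) ⟩
      x * y                 ∎)

    C₀-^ : ∀ {x} n → C₀ x → C₀ (x ^ n)
    C₀-^ zero    _  = 1∈C₀
    C₀-^ (suc n) cx = C₀-* cx (C₀-^ n cx)

    C₀-· : ∀ {x} n → C₀ x → C₀ (n · x)
    C₀-· zero    _  = 0∈C₀
    C₀-· (suc n) cx = C₀-+ cx (C₀-· n cx)

    C₀-neg : ∀ {x} → C₀ x → C₀ (- x)
    C₀-neg {x} cx = reach-resp (C₀-· (proj₁ (-x≈n·x x)) cx) (sym (proj₂ (-x≈n·x x)))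

    C₀-inverse : ∀ {x y} → C₀ x → x * y ≈ 1# → C₀ y
    C₀-inverse {x} {y} cx xy≈1 =
      reach-resp (C₀-^ n cx) (*-cancelˡ-≉0 x≉0 (trans xⁿ⁺¹≈1 (sym xy≈1)))
      where
      x≉0 : x ≉ 0#
      x≉0 x≈0 = nontrivial (trans (sym (zeroˡ y)) (trans (*-congʳ (sym x≈0)) xy≈1))
      n = proj₁ (^-period x≉0)
      xⁿ⁺¹≈1 = proj₂ (^-period x≉0)

    -- Intermediate vertices range over Fin size rather than Carrier, so that Reach≤ t is decidable.
    Reach≤ : ℕ → Carrier → Set
    Reach≤ zero    x = 0# ≈ x
    Reach≤ (suc t) x = Reach≤ t x ⊎ ∃ λ (w : Fin size) → Reach≤ t (enum w) × S (x - enum w)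

    Reach≤? : ∀ t x → Dec (Reach≤ t x)
    Reach≤? zero    x = 0# ≟ x
    Reach≤? (suc t) x = Reach≤? t x ⊎-dec Fin.any? (λ w → Reach≤? t (enum w) ×-dec S? (x - enum w))

    Reach≤-resp : ∀ t {x y} → x ≈ y → Reach≤ t x → Reach≤ t y
    Reach≤-resp zero    x≈y 0≈x                   = trans 0≈x x≈y
    Reach≤-resp (suc t) x≈y (inj₁ r)              = inj₁ (Reach≤-resp t x≈y r)
    Reach≤-resp (suc t) x≈y (inj₂ (w , rw , adj)) = inj₂ (w , rw , S-resp (+-congʳ x≈y) adj)

    Reach≤⇒C₀ : ∀ t {x} → Reach≤ t x → C₀ x
    Reach≤⇒C₀ zero    0≈x                   = here 0≈x
    Reach≤⇒C₀ (suc t) (inj₁ r)              = Reach≤⇒C₀ t r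
    Reach≤⇒C₀ (suc t) (inj₂ (w , rw , adj)) = step (Reach≤⇒C₀ t rw) adj

    C₀⇒Reach≤ : ∀ {x} → C₀ x → ∃ λ t → Reach≤ t x
    C₀⇒Reach≤ (here 0≈x) = 0 , 0≈x
    C₀⇒Reach≤ (step {w} r adj) with C₀⇒Reach≤ r
    ... | t , rw = suc t , inj₂ (index w , Reach≤-resp t (sym (enum-index w)) rw ,
                                 S-resp (+-congˡ (-‿cong (sym (enum-index w)))) adj)

    Reach≤-bounded : ∃ λ t → ∀ s {x} → Reach≤ s x → Reach≤ t x
    Reach≤-bounded = t , saturate
      where
      chain : ∃ λ t → ∀ {i} → Reach≤ (suc t) (enum i) → Reach≤ t (enum i)
      chain = decidable-chain-stabilises (λ t i → Reach≤? t (enum i)) (λ t → inj₁)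
      t = proj₁ chain

      stable : ∀ {x} → Reach≤ (suc t) x → Reach≤ t x
      stable {x} r =
        Reach≤-resp t (enum-index x) (proj₂ chain (Reach≤-resp (suc t) (sym (enum-index x)) r))

      Reach≤-zero : ∀ s {x} → Reach≤ 0 x → Reach≤ s x
      Reach≤-zero zero    r = r
      Reach≤-zero (suc s) r = inj₁ (Reach≤-zero s r)

      saturate : ∀ s {x} → Reach≤ s x → Reach≤ t x
      saturate zero    r                      = Reach≤-zero t r
      saturate (suc s) (inj₁ r)               = saturate s r
      saturate (suc s) (inj₂ (w , rw , adj))  = stable (inj₂ (w , saturate s rw , adj))

    C₀? : ∀ x → Dec (C₀ x)
    C₀? x = map′ (Reach≤⇒C₀ t) (λ c → let s , r = C₀⇒Reach≤ c in saturate s r) (Reach≤? t x)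
      where
      t = proj₁ Reach≤-bounded
      saturate = proj₂ Reach≤-bounded

    component-iso : ∀ u → ComponentIso F ω k u C₀ S
    component-iso u = record
      { to        = λ (x , r) → x - u , reach⇒C₀ r
      ; from      = λ (x , c) → x + u , C₀⇒reach (reach-resp c (sym (x+y-y≈x x u)))
      ; to-cong   = λ _ _ → +-congʳ
      ; from-cong = λ _ _ → +-congʳ
      ; from-to   = λ (x , _) → x-y+y≈x x u
      ; to-from   = λ (y , _) → x+y-y≈x y u
      ; adj-pres  = λ (x , _) (y , _) →
          mk⇔ (S-resp (sym ([x+z]-[y+z]≈x-y y x (- u)))) (S-resp ([x+z]-[y+z]≈x-y y x (- u)))
      }

  module SubfieldComponent {ω : Carrier} (prim : IsPrimitive F ω) (k : ℕ) where
    open Cyclic prim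
    open Component ω≉0 k

    private
      module Step = LeastExponent ω≉0 C₀? (λ x≈y c → reach-resp c x≈y) 1∈C₀ C₀-* C₀-inverse
        {order} (reach-resp 1∈C₀ (sym ω^order≈1))

    m : ℕ
    m = Step.exponent

    η : Carrier
    η = ω ^ m

    η^i≈ω^[i*m] : ∀ i → η ^ i ≈ ω ^ (i ℕ.* m)
    η^i≈ω^[i*m] i = sym (^-* ω i m)

    m∣order : m ∣ order
    m∣order = Step.exponent-∣ (reach-resp 1∈C₀ (sym ω^order≈1))

    m∣k : m ∣ k
    m∣k = Step.exponent-∣ (S⊆C₀ (1 , ^-≡ ω (≡.sym (ℕ.*-identityˡ k))))

    N : ℕ
    N = quotient m∣order

    order≡N*m : order ≡ N ℕ.* m
    order≡N*m = _∣_.equality m∣order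

    η-^-injective : ∀ {i j} → i < N → j < N → η ^ i ≈ η ^ j → i ≡ j
    η-^-injective {i} {j} i<N j<N ηⁱ≈ηʲ = ℕ.*-cancelʳ-≡ i j m
      (^-injective (below i<N) (below j<N) (trans (sym (η^i≈ω^[i*m] i)) (trans ηⁱ≈ηʲ (η^i≈ω^[i*m] j))))
      where
      below : ∀ {i} → i < N → i ℕ.* m < order
      below {i} i<N = ≡.subst (i ℕ.* m <_) (≡.sym order≡N*m) (ℕ.*-monoˡ-< m i<N)

    η-log : ∀ {x} → C₀ x → x ≉ 0# → ∃ λ i → i < N × η ^ i ≈ x
    η-log {x} cx x≉0 = i , i<N , trans (η^i≈ω^[i*m] i) (trans (^-≡ ω (≡.sym e≡i*m)) ωᵉ≈x)
      where
      e = proj₁ (log x≉0)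
      ωᵉ≈x = proj₂ (proj₂ (log x≉0))
      m∣e : m ∣ e
      m∣e = Step.exponent-∣ (reach-resp cx (sym ωᵉ≈x))
      i = quotient m∣e
      e≡i*m = _∣_.equality m∣e
      i<N : i < N
      i<N = ℕ.*-cancelʳ-< m i N (≡.subst₂ _<_ e≡i*m order≡N*m (proj₁ (proj₂ (log x≉0))))

    subfield : Subfield F C₀ (suc N)
    subfield = record
      { resp       = λ x≈y c → reach-resp c x≈y
      ; has-0      = 0∈C₀
      ; has-1      = 1∈C₀
      ; +-clos     = C₀-+
      ; neg-clos   = C₀-neg
      ; *-clos     = C₀-*
      ; inv-clos   = C₀-inverse
      ; enumP      = zeroAndPowers η N
      ; enumP-in   = λ { Fin.zero → 0∈C₀ ; (Fin.suc i) → C₀-^ (toℕ i) Step.H-ω^exponent }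
      ; enumP-inj  = λ i j → zeroAndPowers-injective (^-≉0 m ω≉0) η-^-injective
      ; enumP-surj = λ x cx → zeroAndPowers-reaches (η-log cx)
      }

    η-primitive : IsPrimitiveIn F C₀ η
    η-primitive = Step.H-ω^exponent , ^-≉0 m ω≉0 , λ x cx x≉0 →
      let (i , _ , ηⁱ≈x) = η-log cx x≉0 in i , ηⁱ≈x

    k′ : ℕ
    k′ = quotient m∣k

    k≡m*k′ : k ≡ m ℕ.* k′
    k≡m*k′ = ≡.trans (_∣_.equality m∣k) (ℕ.*-comm k′ m)

    S⇔S[η,k′] : ∀ x → InS F ω k x ⇔ InS F η k′ x
    S⇔S[η,k′] x = mk⇔ (λ (j , x≈) → j , trans x≈ (ω^[j*k]≈η^[j*k′] j))
                      (λ (j , x≈) → j , trans x≈ (sym (ω^[j*k]≈η^[j*k′] j)))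
      where
      ω^[j*k]≈η^[j*k′] : ∀ j → ω ^ (j ℕ.* k) ≈ η ^ (j ℕ.* k′)
      ω^[j*k]≈η^[j*k′] j = begin
        ω ^ (j ℕ.* k)              ≈⟨ ^-≡ ω (≡.cong (j ℕ.*_) (_∣_.equality m∣k)) ⟩
        ω ^ (j ℕ.* (k′ ℕ.* m))     ≈⟨ ^-≡ ω (≡.sym (ℕ.*-assoc j k′ m)) ⟩
        ω ^ (j ℕ.* k′ ℕ.* m)       ≈⟨ sym (η^i≈ω^[i*m] (j ℕ.* k′)) ⟩
        η ^ (j ℕ.* k′)             ∎


  module Span {P : Carrier → Set} {c : ℕ} (K : Subfield F P c) where
    open Subfield K

    combination : ∀ {e} → Vec Carrier e → Vec (Fin c) e → Carrier
    combination []       []       = 0#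
    combination (v ∷ vs) (a ∷ as) = enumP a * v + combination vs as

    InSpan : ∀ {e} → Vec Carrier e → Carrier → Set
    InSpan vs x = ∃ λ as → combination vs as ≈ x

    Independent : ∀ {e} → Vec Carrier e → Set
    Independent vs = ∀ {as bs} → combination vs as ≈ combination vs bs → as ≡ bs

    coordinate : ∀ {x} → P x → Fin c
    coordinate {x} px = proj₁ (enumP-surj x px)

    enumP-coordinate : ∀ {x} (px : P x) → enumP (coordinate px) ≈ x
    enumP-coordinate {x} px = proj₂ (enumP-surj x px)

    span-resp : ∀ {e} (vs : Vec Carrier e) {x y} → x ≈ y → InSpan vs x → InSpan vs y
    span-resp vs x≈y (as , eq) = as , trans eq x≈y

    span-+ : ∀ {e} (vs : Vec Carrier e) {x y} → InSpan vs x → InSpan vs y → InSpan vs (x + y)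
    span-+ []       ([] , 0≈x) ([] , 0≈y) = [] , trans (sym (+-identityʳ 0#)) (+-cong 0≈x 0≈y)
    span-+ (v ∷ vs) {x} {y} (a ∷ as , eqx) (b ∷ bs , eqy) = coordinate a+b∈P ∷ proj₁ rest , (begin
      enumP (coordinate a+b∈P) * v + combination vs (proj₁ rest)
        ≈⟨ +-cong (*-congʳ (enumP-coordinate a+b∈P)) (proj₂ rest) ⟩
      (enumP a + enumP b) * v + (combination vs as + combination vs bs)
        ≈⟨ +-congʳ (distribʳ v (enumP a) (enumP b)) ⟩
      (enumP a * v + enumP b * v) + (combination vs as + combination vs bs)
        ≈⟨ interchange _ _ _ _ ⟩
      (enumP a * v + combination vs as) + (enumP b * v + combination vs bs)
        ≈⟨ +-cong eqx eqy ⟩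
      x + y ∎)
      where
      a+b∈P = +-clos (enumP-in a) (enumP-in b)
      rest = span-+ vs (as , refl) (bs , refl)

    span-scale : ∀ {e} (vs : Vec Carrier e) {l x} → P l → InSpan vs x → InSpan vs (l * x)
    span-scale []       {l} _  ([] , 0≈x) = [] , trans (sym (zeroʳ l)) (*-congˡ 0≈x)
    span-scale (v ∷ vs) {l} {x} l∈P (a ∷ as , eqx) = coordinate la∈P ∷ proj₁ rest , (begin
      enumP (coordinate la∈P) * v + combination vs (proj₁ rest)
        ≈⟨ +-cong (*-congʳ (enumP-coordinate la∈P)) (proj₂ rest) ⟩
      (l * enumP a) * v + l * combination vs as
        ≈⟨ +-congʳ (*-assoc l (enumP a) v) ⟩
      l * (enumP a * v) + l * combination vs as
        ≈⟨ sym (distribˡ l _ _) ⟩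
      l * (enumP a * v + combination vs as)
        ≈⟨ *-congˡ eqx ⟩
      l * x ∎)
      where
      la∈P = *-clos l∈P (enumP-in a)
      rest = span-scale vs l∈P (as , refl)

    independent-[] : Independent []
    independent-[] {[]} {[]} _ = ≡.refl

    independent-∷ : ∀ {e} {vs : Vec Carrier e} {v} → Independent vs → ¬ InSpan vs v →
      Independent (v ∷ vs)
    independent-∷ {vs = vs} {v} independent v∉span {a ∷ as} {b ∷ bs} eq with a Fin.≟ b
    ... | yes ≡.refl = ≡.cong (a ∷_) (independent (∙-cancelˡ (enumP a * v) _ _ eq))
    ... | no a≢b = ⊥-elim (v∉span (span-resp vs ι[Σb-Σa]≈v
          (span-+ vs (span-scale vs ι∈P (bs , refl)) (span-scale vs (neg-clos ι∈P) (as , refl)))))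
      where
      δ = enumP a - enumP b
      δ≉0 : δ ≉ 0#
      δ≉0 δ≈0 = a≢b (enumP-inj a b (x∙y⁻¹≈ε⇒x≈y (enumP a) (enumP b) δ≈0))
      ι = proj₁ (inverse δ δ≉0)
      ι∈P : P ι
      ι∈P = inv-clos (+-clos (enumP-in a) (neg-clos (enumP-in b))) (proj₂ (inverse δ δ≉0))
      ι[Σb-Σa]≈v : ι * combination vs bs + - ι * combination vs as ≈ v
      ι[Σb-Σa]≈v = begin
        ι * combination vs bs + - ι * combination vs as
          ≈⟨ +-congˡ (sym (-‿distribˡ-* ι _)) ⟩
        ι * combination vs bs - ι * combination vs as
          ≈⟨ sym (x[y-z]≈xy-xz ι _ _) ⟩
        ι * (combination vs bs - combination vs as)
          ≈⟨ *-congˡ (sym (trans ([y-z]x≈yx-zx v (enumP a) (enumP b)) (x+y≈z+w⇒x-z≈w-y eq))) ⟩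
        ι * (δ * v)
          ≈⟨ sym (*-assoc ι δ v) ⟩
        (ι * δ) * v
          ≈⟨ *-congʳ (trans (*-comm ι δ) (proj₂ (inverse δ δ≉0))) ⟩
        1# * v
          ≈⟨ *-identityˡ v ⟩
        v ∎

    coefficients↔ : ∀ e → Fin (c ℕ.^ e) ↔ Vec (Fin c) e
    coefficients↔ e = ↔-trans (Fin[m^n]↔Fin[m]^n c e) (↔Vec e)

    module _ {e} (vs : Vec Carrier e) where
      open Inverse (coefficients↔ e)

      combination-from : ∀ as → combination vs (to (from as)) ≈ combination vs as
      combination-from as = reflexive (≡.cong (combination vs) (strictlyInverseˡ as))

      InSpan? : ∀ x → Dec (InSpan vs x)
      InSpan? x = map′ (λ (i , eq) → to i , eq)
                       (λ (as , eq) → from as , trans (combination-from as) eq)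
                       (Fin.any? λ i → combination vs (to i) ≟ x)

      independent⇒≤ : Independent vs → c ℕ.^ e ≤ size
      independent⇒≤ independent = ≤-size (combination vs ∘ to) λ {i} {j} eq →
        ≡.trans (≡.sym (strictlyInverseʳ i))
                (≡.trans (≡.cong from (independent eq)) (strictlyInverseʳ j))

      spanning⇒≥ : (∀ x → InSpan vs x) → size ≤ c ℕ.^ e
      spanning⇒≥ spans = size-≤ (combination vs ∘ to) λ x →
        from (proj₁ (spans x)) , trans (combination-from (proj₁ (spans x))) (proj₂ (spans x))

      outside-span? : (∃ λ v → ¬ InSpan vs v) ⊎ (∀ x → InSpan vs x)
      outside-span? with Fin.any? (λ i → ¬? (InSpan? (enum i)))
      ... | yes (i , v∉) = inj₁ (enum i , v∉)
      ... | no none      = inj₂ λ x → decidable-stable (InSpan? x)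
        λ x∉ → none (index x , λ v∈ → x∉ (span-resp vs (enum-index x) v∈))

    2≤c : 2 ≤ c
    2≤c = Fin.injective⇒≤ {f = zeroOrOne} injective
      where
      zeroOrOne : Fin 2 → Fin c
      zeroOrOne Fin.zero    = coordinate has-0
      zeroOrOne (Fin.suc _) = coordinate has-1

      0≢1 : coordinate has-0 ≢ coordinate has-1
      0≢1 eq = nontrivial (trans (sym (enumP-coordinate has-0))
                          (trans (reflexive (≡.cong enumP eq)) (enumP-coordinate has-1)))

      injective : ∀ {i j} → zeroOrOne i ≡ zeroOrOne j → i ≡ j
      injective {Fin.zero}          {Fin.zero}          _  = ≡.refl
      injective {Fin.zero}          {Fin.suc Fin.zero}  eq = ⊥-elim (0≢1 eq)
      injective {Fin.suc Fin.zero}  {Fin.zero}          eq = ⊥-elim (0≢1 (≡.sym eq))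
      injective {Fin.suc Fin.zero}  {Fin.suc Fin.zero}  _  = ≡.refl

    extend-to-basis : ∀ fuel {e} (vs : Vec Carrier e) → Independent vs → size < e ℕ.+ fuel →
      ∃ λ d → e ≤ d × size ≡ c ℕ.^ d
    extend-to-basis fuel {e} vs independent bound with outside-span? vs
    ... | inj₂ spans =
      e , ℕ.≤-refl , ℕ.≤-antisym (spanning⇒≥ vs spans) (independent⇒≤ vs independent)
    extend-to-basis zero {e} vs independent bound | inj₁ _ = ⊥-elim (ℕ.<-irrefl ≡.refl
      (ℕ.<-trans (≡.subst (size <_) (ℕ.+-identityʳ e) bound)
                 (ℕ.<-≤-trans (n<c^n 2≤c e) (independent⇒≤ vs independent))))
    extend-to-basis (suc fuel) {e} vs independent bound | inj₁ (v , v∉) =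
      let d , e<d , size≡ = extend-to-basis fuel (v ∷ vs) (independent-∷ independent v∉)
                              (≡.subst (size <_) (ℕ.+-suc e fuel) bound)
      in d , ℕ.<⇒≤ e<d , size≡

    dimension≥2 : ∀ {w} → ¬ P w → ∃ λ d → 2 ≤ d × size ≡ c ℕ.^ d
    dimension≥2 {w} w∉P = extend-to-basis size (w ∷ 1# ∷ [])
      (independent-∷ (independent-∷ independent-[] 1∉span[]) w∉span[1]) (s≤s (ℕ.m≤n+m size 1))
      where
      1∉span[] : ¬ InSpan [] 1#
      1∉span[] ([] , 0≈1) = nontrivial 0≈1

      w∉span[1] : ¬ InSpan (1# ∷ []) w
      w∉span[1] (a ∷ [] , eq) = w∉P (resp eq (+-clos (*-clos (enumP-in a) has-1) has-0))

open import Data.Nat using (_^_; _∸_; _*_)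

theorem3p4 : (F : FiniteField) (p R k : ℕ) (ω : FiniteField.Carrier F) →
    Prime p → 1 ≤ R → FiniteField.size F ≡ p ^ R →
    2 ≤ k → (k∣ : k ∣ p ^ R ∸ 1) → (¬ (2 ∣ p) → 2 ∣ quotient k∣) →
    IsPrimitive F ω →
    Disconnected F ω k →
    ∃ λ (a : ℕ) → a ∣ R × a < R ×
      Σ (FiniteField.Carrier F → Set) λ P →
        Subfield F P (p ^ a) ×
        (∀ x → InS F ω k x → P x) ×
        ∃ λ (k′ : ℕ) → ∃ λ (m : ℕ) →
          p ^ R ∸ 1 ≡ m * (p ^ a ∸ 1) × k ≡ m * k′ ×
          ∃ λ (η : FiniteField.Carrier F) →
            IsPrimitiveIn F P η ×
            (∀ x → InS F ω k x ⇔ InS F η k′ x) ×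
            (∀ u → ComponentIso F ω k u P (InS F ω k))
-- The conditions on k only make S symmetric in the paper; C₀ is closed under negation
-- regardless.
theorem3p4 F p R k ω p-prime 1≤R size≡pᴿ _ _ _ prim (u , v , ¬u↝v) =
  a , a∣R , a<R , C₀ , ≡.subst (Subfield F C₀) c≡pᵃ subfield , (λ _ → S⊆C₀) ,
  k′ , m , pᴿ-1≡m*[pᵃ-1] , k≡m*k′ , η , η-primitive , S⇔S[η,k′] , component-iso
  where
  open FiniteField F using (_-_)
  open FieldTheory F using (module Cyclic; module Component; module SubfieldComponent; module Span)
  open Cyclic prim using (ω≉0; order; size≡1+order)
  open Component ω≉0 k using (C₀; S⊆C₀; C₀⇒reach; component-iso)
  open SubfieldComponent prim k
  open Span subfield using (dimension≥2)

  dimension = dimension≥2 {v - u} (¬u↝v ∘ C₀⇒reach)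
  exponent = subfield-exponent p-prime (proj₁ (proj₂ dimension)) 1≤R
               (≡.trans (≡.sym (proj₂ (proj₂ dimension))) size≡pᴿ)
  a = proj₁ exponent
  c≡pᵃ = proj₁ (proj₂ exponent)
  a∣R = proj₁ (proj₂ (proj₂ exponent))
  a<R = proj₂ (proj₂ (proj₂ exponent))

  pᴿ-1≡m*[pᵃ-1] : p ^ R ∸ 1 ≡ m * (p ^ a ∸ 1)
  pᴿ-1≡m*[pᵃ-1] = begin
    p ^ R ∸ 1                      ≡⟨ ≡.cong (_∸ 1) (≡.trans (≡.sym size≡pᴿ) size≡1+order) ⟩
    order                          ≡⟨ order≡N*m ⟩
    N * m                          ≡⟨ ℕ.*-comm N m ⟩
    m * (suc N ∸ 1)                ≡⟨ ≡.cong (λ c → m * (c ∸ 1)) c≡pᵃ ⟩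
    m * (p ^ a ∸ 1)                ∎
    where open ≡.≡-Reasoning
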